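{- Let $A\in\mathcal T$ and let $\mathfrak A_1,\dots,\mathfrak A_n$ be trees, none rooted at $\oplus$, such that $\mathsf T(A)=\bigoplus_{i\in1..n}\mathfrak A_i$. Then there exist $n'\le n$, maximal $\oplus$-contexts $\mathcal C,\mathcal C_1,\dots,\mathcal C_{n'}$, types $A_1,\dots,A_{n'}$ none rooted at $\oplus$, and functions $s,t:1..n'\to1..n$ such that $A=\mathcal C[A_1,\dots,A_{n'}]$ and $\mathsf T(A_l)=\mathcal C_l[\mathfrak A_{s(l)},\dots,\mathfrak A_{t(l)}]$ for every $l\in1..n'$.
   Context: $\mu$-types: datatypes $D ::= \alpha\mid c\mid D\mathbin{@}A\mid D\oplus D\mid\mu\alpha.D$, types $A ::= X\mid D\mid A\supset A\mid A\oplus A\mid\mu X.A$ (datatype variables $\alpha$, type variables $X$, constants $c$; $a$ ranges over variables and constants), contractive ($V$ in $\mu V.A$ occurs only under $\supset$ or $@$); $\mathcal T$ is the set of such types. $\mathsf T(A)$ is the full unfolding of $A$ into a possibly infinite binary tree: $\mathsf T(a)(\epsilon)=a$; $\mathsf T(A_1\star A_2)(\epsilon)=\star$, $\mathsf T(A_1\star A_2)(i\pi)=\mathsf T(A_i)(\pi)$ for $\star\in\{@,\supset,\oplus\}$; $\mathsf T(\mu V.A)=\mathsf T(A\{\mu V.A/V\})$. A maximal union of trees $\bigoplus_{i\in1..n}\mathfrak A_i$ is a tree whose top part consists of $\oplus$ nodes with frontier subtrees $\mathfrak A_1,\dots,\mathfrak A_n$ (left to right). A $\oplus$-context is a multi-hole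 context built from $\Box$ and $\oplus$ only; it is maximal (for given fillers) when none of its fillers is rooted at $\oplus$. -}

module Defs where

open import Data.Nat as ℕ using (ℕ; zero; suc; _∸_; compare; less; equal; greater; _<ᵇ_)
open import Data.Nat.Properties using (≤-trans; ≤-<-trans; ≤-reflexive; +-monoʳ-≤; m+[n∸m]≡n)
open import Data.Fin as Fin using (Fin; toℕ; fromℕ<; _↑ˡ_; _↑ʳ_)
open import Data.Fin.Properties using (toℕ<n)
open import Data.List using (List; []; _∷_; _∷ʳ_)
open import Data.Maybe using (Maybe; just; nothing)
open import Data.Product using (Σ; ∃; _×_; _,_)
open import Data.Bool using (if_then_else_)
open import Function using (_∘_)
open import Relation.Binary.PropositionalEquality using (_≡_)
open import Relation.Nullary using (¬_)

-- Syntax of μ-types (de Bruijn indices; one index space for both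
-- datatype variables α and type variables X, distinguished by kinds)

data Op : Set where
  opAt opArr opPlus : Op

data Ty : Set where
  var : ℕ → Ty
  con : ℕ → Ty
  bin : Op → Ty → Ty → Ty
  μ   : Ty → Ty                   -- μV.A  (binds index 0)

data Kind : Set where
  dt ty : Kind

lookupK : List Kind → ℕ → Maybe Kind
lookupK []      _       = nothing
lookupK (k ∷ Γ) zero    = just k
lookupK (k ∷ Γ) (suc i) = lookupK Γ i

mutual
  data _⊢D_ (Γ : List Kind) : Ty → Set where
    dvar  : ∀ {i} → lookupK Γ i ≡ just dt → Γ ⊢D var i
    dcon  : ∀ {c} → Γ ⊢D con c
    dat   : ∀ {D A} → Γ ⊢D D → Γ ⊢T A → Γ ⊢D bin opAt D A
    dplus : ∀ {D₁ D₂} → Γ ⊢D D₁ → Γ ⊢D D₂ → Γ ⊢D bin opPlus D₁ D₂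
    dmu   : ∀ {D} → (dt ∷ Γ) ⊢D D → Γ ⊢D μ D

  data _⊢T_ (Γ : List Kind) : Ty → Set where
    tvar  : ∀ {i} → lookupK Γ i ≡ just ty → Γ ⊢T var i
    tdt   : ∀ {D} → Γ ⊢D D → Γ ⊢T D
    tarr  : ∀ {A B} → Γ ⊢T A → Γ ⊢T B → Γ ⊢T bin opArr A B
    tplus : ∀ {A B} → Γ ⊢T A → Γ ⊢T B → Γ ⊢T bin opPlus A B
    tmu   : ∀ {A} → (ty ∷ Γ) ⊢T A → Γ ⊢T μ A

data Guarded (k : ℕ) : Ty → Set where
  gvar  : ∀ {i} → ¬ (i ≡ k) → Guarded k (var i)
  gcon  : ∀ {c} → Guarded k (con c)
  gat   : ∀ {A B} → Guarded k (bin opAt A B)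
  garr  : ∀ {A B} → Guarded k (bin opArr A B)
  gplus : ∀ {A B} → Guarded k A → Guarded k B → Guarded k (bin opPlus A B)
  gmu   : ∀ {A} → Guarded (suc k) A → Guarded k (μ A)

data Contractive : Ty → Set where
  cvar : ∀ {i} → Contractive (var i)
  ccon : ∀ {c} → Contractive (con c)
  cbin : ∀ {o A B} → Contractive A → Contractive B → Contractive (bin o A B)
  cmu  : ∀ {A} → Guarded 0 A → Contractive A → Contractive (μ A)

-- membership in 𝒯 (free variables allowed, with kinds recorded in Γ)
InT : List Kind → Ty → Set
InT Γ A = Γ ⊢T A × Contractive A

shift : ℕ → Ty → Ty
shift c (var i)     = if i <ᵇ c then var i else var (suc i)
shift c (con x)     = con x
shift c (bin o A B) = bin o (shift c A) (shift c B)
shift c (μ A)       = μ (shift (suc c) A)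

-- sub k u A : substitute u for index k in A (indices above k decremented)
sub : ℕ → Ty → Ty → Ty
sub k u (var i) with compare i k
... | less .i _    = var i
... | equal .i     = u
... | greater .k j = var (k ℕ.+ j)
sub k u (con x)     = con x
sub k u (bin o A B) = bin o (sub k u A) (sub k u B)
sub k u (μ A)       = μ (sub (suc k) (shift 0 u) A)

data Dir : Set where
  d1 d2 : Dir

Pos : Set
Pos = List Dir

data Label : Set where
  lvar  : ℕ → Label
  lcon  : ℕ → Label
  lnode : Op → Label

Tree : Set
Tree = Pos → Maybe Label

record IsTree (t : Tree) : Set where
  field
    root  : ∃ λ l → t [] ≡ just l
    child : ∀ π d → ((∃ λ l → t (π ∷ʳ d) ≡ just l) → (∃ λ o → t π ≡ just (lnode o)))
                  × ((∃ λ o → t π ≡ just (lnode o)) → (∃ λ l → t (π ∷ʳ d) ≡ just l))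

-- Unf A π l  :  T(A)(π) = l
data Unf : Ty → Pos → Label → Set where
  uvar  : ∀ {i} → Unf (var i) [] (lvar i)
  ucon  : ∀ {c} → Unf (con c) [] (lcon c)
  uroot : ∀ {o A B} → Unf (bin o A B) [] (lnode o)
  uleft : ∀ {o A B π l} → Unf A π l → Unf (bin o A B) (d1 ∷ π) l
  uright : ∀ {o A B π l} → Unf B π l → Unf (bin o A B) (d2 ∷ π) l
  umu   : ∀ {A π l} → Unf (sub 0 (μ A) A) π l → Unf (μ A) π l

TEq : Ty → Tree → Set
TEq A t = ∀ π l → (Unf A π l → t π ≡ just l) × (t π ≡ just l → Unf A π l)

-- ⊕-contexts with n holes (holes numbered left to right)

data Ctx : ℕ → Set where
  hole : Ctx 1
  _⊕_  : ∀ {m n} → Ctx m → Ctx n → Ctx (m ℕ.+ n)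

plugTy : ∀ {n} → Ctx n → (Fin n → Ty) → Ty
plugTy hole f = f Fin.zero
plugTy (_⊕_ {m} {n} C₁ C₂) f =
  bin opPlus (plugTy C₁ (f ∘ (_↑ˡ n))) (plugTy C₂ (f ∘ (m ↑ʳ_)))

plugT : ∀ {n} → Ctx n → (Fin n → Tree) → Tree
plugT hole f π = f Fin.zero π
plugT (_⊕_ {m} {n} C₁ C₂) f [] = just (lnode opPlus)
plugT (_⊕_ {m} {n} C₁ C₂) f (d1 ∷ π) = plugT C₁ (f ∘ (_↑ˡ n)) π
plugT (_⊕_ {m} {n} C₁ C₂) f (d2 ∷ π) = plugT C₂ (f ∘ (m ↑ʳ_)) π

RootedPlusTy : Ty → Set
RootedPlusTy A = ∃ λ B → ∃ λ C → A ≡ bin opPlus B C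

RootedPlusT : Tree → Set
RootedPlusT t = t [] ≡ just (lnode opPlus)

MaximalTy : ∀ {n} → Ctx n → (Fin n → Ty) → Set
MaximalTy {n} C f = ∀ i → ¬ RootedPlusTy (f i)

MaximalT : ∀ {n} → Ctx n → (Fin n → Tree) → Set
MaximalT {n} C f = ∀ i → ¬ RootedPlusT (f i)

IsMaxUnion : Ty → ∀ {n} → (Fin n → Tree) → Set
IsMaxUnion A {n} 𝔄 = Σ (Ctx n) λ C → MaximalT C 𝔄 × TEq A (plugT C 𝔄)

-- consecutive slices 𝔄_s, …, 𝔄_t  (indices 0-based)

width : ∀ {n} → Fin n → Fin n → ℕ
width s t = suc (toℕ t ∸ toℕ s)

private
  slice-bound : ∀ {n} (s t : Fin n) → s Fin.≤ t → (j : Fin (width s t)) →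
                toℕ s ℕ.+ toℕ j ℕ.< n
  slice-bound s t s≤t j =
    ≤-<-trans (≤-trans (+-monoʳ-≤ (toℕ s) (ℕ.s≤s⁻¹ (toℕ<n j)))
                       (≤-reflexive (m+[n∸m]≡n s≤t)))
              (toℕ<n t)

slice : ∀ {a} {X : Set a} {n} → (Fin n → X) → (s t : Fin n) → s Fin.≤ t →
        Fin (width s t) → X
slice f s t s≤t j = f (fromℕ< (slice-bound s t s≤t j))

module Submission where

-- Write T(A) = C[𝔄₁,…,𝔄ₙ] with C a maximal ⊕-context.  We
-- peel the ⊕-nodes of A off in lock-step with those of C.  If A = B ⊕ D
-- then C cannot be a bare hole (the filler would be rooted at ⊕), so
-- C = C₁ ⊕ C₂ and T(B) = C₁[first fillers], T(D) = C₂[remaining fillers];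
-- decomposing B and D recursively and joining the results decomposes A.
-- If A is not rooted at ⊕ it is itself the only part, covering all n
-- fillers with the context C.

open import Defs
open import Data.Nat using (ℕ; _≤_)
open import Data.Fin as Fin using (Fin)
open import Data.List using (List)
open import Data.Product using (Σ; _×_)
open import Relation.Binary.PropositionalEquality using (_≡_)
open import Relation.Nullary using (¬_)

open import Data.Nat using (suc; _+_; _∸_; z≤n; s≤s)
open import Data.Nat.Properties using (+-monoʳ-≤; +-mono-≤; +-assoc; [m+n]∸[m+o]≡n∸o)
open import Data.Fin using (toℕ; fromℕ; _↑ˡ_; _↑ʳ_; cast)
open import Data.Fin.Properties using (toℕ-injective; toℕ-fromℕ<; toℕ-fromℕ; toℕ-cast; cast-is-id; toℕ-↑ˡ; toℕ-↑ʳ)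
open import Data.Vec.Functional using (_++_)
open import Data.Vec.Functional.Properties using (lookup-++ˡ; lookup-++ʳ)
open import Data.List using ([]; _∷_)
open import Data.Product using (∃; _,_; proj₁; proj₂)
open import Data.Sum using (inj₁; inj₂)
open import Data.Empty using (⊥-elim)
open import Function using (_∘_)
open import Relation.Binary.PropositionalEquality
  using (refl; sym; trans; cong; cong₂; cong-app; subst; subst₂; module ≡-Reasoning)

TEq-resp : ∀ {B} {t t′ : Tree} → (∀ π → t π ≡ t′ π) → TEq B t → TEq B t′
TEq-resp e q π l = (λ u → trans (sym (e π)) (proj₁ (q π l) u))
                 , (λ h → proj₂ (q π l) (trans (e π) h))

TEq-left : ∀ {o B D} {t : Tree} → TEq (bin o B D) t → TEq B (λ π → t (d1 ∷ π))
TEq-left q π l = (λ u → proj₁ (q (d1 ∷ π) l) (uleft u))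
               , (λ h → unleft (proj₂ (q (d1 ∷ π) l) h))
  where
  unleft : ∀ {o B D π l} → Unf (bin o B D) (d1 ∷ π) l → Unf B π l
  unleft (uleft u) = u

TEq-right : ∀ {o B D} {t : Tree} → TEq (bin o B D) t → TEq D (λ π → t (d2 ∷ π))
TEq-right q π l = (λ u → proj₁ (q (d2 ∷ π) l) (uright u))
                , (λ h → unright (proj₂ (q (d2 ∷ π) l) h))
  where
  unright : ∀ {o B D π l} → Unf (bin o B D) (d2 ∷ π) l → Unf D π l
  unright (uright u) = u

plugT-cong : ∀ {n} (C : Ctx n) {f g : Fin n → Tree} → (∀ i → f i ≡ g i) →
             ∀ π → plugT C f π ≡ plugT C g π
plugT-cong hole e π = cong-app (e Fin.zero) π
plugT-cong (C₁ ⊕ C₂) e [] = refl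
plugT-cong (_⊕_ {m} {k} C₁ C₂) e (d1 ∷ π) = plugT-cong C₁ (λ i → e (i ↑ˡ k)) π
plugT-cong (_⊕_ {m} {k} C₁ C₂) e (d2 ∷ π) = plugT-cong C₂ (λ i → e (m ↑ʳ i)) π

plugTy-cong : ∀ {n} (C : Ctx n) {f g : Fin n → Ty} → (∀ i → f i ≡ g i) →
              plugTy C f ≡ plugTy C g
plugTy-cong hole e = e Fin.zero
plugTy-cong (_⊕_ {m} {k} C₁ C₂) e =
  cong₂ (bin opPlus) (plugTy-cong C₁ (λ i → e (i ↑ˡ k))) (plugTy-cong C₂ (λ i → e (m ↑ʳ i)))

plugT-cast : ∀ {p q} (e : p ≡ q) (C : Ctx p) (F : Fin p → Tree) (G : Fin q → Tree) →
             (∀ j → F j ≡ G (cast e j)) → ∀ π → plugT C F π ≡ plugT (subst Ctx e C) G π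
plugT-cast refl C F G pw = plugT-cong C (λ j → trans (pw j) (cong G (cast-is-id refl j)))

ctx-nonempty : ∀ {n} → Ctx n → ∃ λ n₀ → n ≡ suc n₀
ctx-nonempty hole = 0 , refl
ctx-nonempty (C₁ ⊕ C₂) with ctx-nonempty C₁
... | _ , refl = _ , refl

slice-lookup : ∀ {n} {X : Set} (f : Fin n → X) (s t : Fin n) (st : s Fin.≤ t)
               (j : Fin (width s t)) →
               ∃ λ i → toℕ i ≡ toℕ s + toℕ j × slice f s t st j ≡ f i
slice-lookup f s t st j = _ , toℕ-fromℕ< _ , refl

record Block {n} (𝔄 : Fin n → Tree) (B : Ty) : Set where
  field
    first last : Fin n
    ordered    : first Fin.≤ last
    ctx        : Ctx (width first last)
    unfolds    : TEq B (plugT ctx (slice 𝔄 first last ordered))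

block-from : ∀ {n p B} (𝔄 : Fin n → Tree) (s t : Fin n) (st : s Fin.≤ t)
             (e : p ≡ width s t) (C : Ctx p) (F : Fin p → Tree) →
             (∀ j → F j ≡ slice 𝔄 s t st (cast e j)) → TEq B (plugT C F) → Block 𝔄 B
block-from 𝔄 s t st e C F pw q = record
  { first = s ; last = t ; ordered = st ; ctx = subst Ctx e C
  ; unfolds = TEq-resp (plugT-cast e C F (slice 𝔄 s t st) pw) q }

block-whole : ∀ {n B} (C : Ctx n) (𝔄 : Fin n → Tree) → TEq B (plugT C 𝔄) → Block 𝔄 B
block-whole C 𝔄 q with ctx-nonempty C
... | n₀ , refl = block-from 𝔄 Fin.zero (fromℕ n₀) z≤n e C 𝔄 pw q
  where
  e : suc n₀ ≡ width {suc n₀} Fin.zero (fromℕ n₀)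
  e = cong suc (sym (toℕ-fromℕ n₀))
  pw : ∀ j → 𝔄 j ≡ slice 𝔄 Fin.zero (fromℕ n₀) z≤n (cast e j)
  pw j with slice-lookup 𝔄 Fin.zero (fromℕ n₀) z≤n (cast e j)
  ... | i , pos , eq = trans (cong 𝔄 (toℕ-injective (sym (trans pos (toℕ-cast e j))))) (sym eq)

block-embed : ∀ {m n B} (𝔄 : Fin n → Tree) (ι : Fin m → Fin n) (offset : ℕ) →
              (∀ i → toℕ (ι i) ≡ offset + toℕ i) → Block (𝔄 ∘ ι) B → Block 𝔄 B
block-embed 𝔄 ι o ι-pos b =
  block-from 𝔄 (ι first) (ι last) ordered′ e ctx _ pw unfolds
  where
  open Block b
  ordered′ : ι first Fin.≤ ι last
  ordered′ = subst₂ _≤_ (sym (ι-pos first)) (sym (ι-pos last)) (+-monoʳ-≤ o ordered)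
  e : width first last ≡ width (ι first) (ι last)
  e = cong suc (trans (sym ([m+n]∸[m+o]≡n∸o o (toℕ last) (toℕ first)))
                      (cong₂ _∸_ (sym (ι-pos last)) (sym (ι-pos first))))
  pw : ∀ j → slice (𝔄 ∘ ι) first last ordered j ≡ slice 𝔄 (ι first) (ι last) ordered′ (cast e j)
  pw j with slice-lookup (𝔄 ∘ ι) first last ordered j
          | slice-lookup 𝔄 (ι first) (ι last) ordered′ (cast e j)
  ... | i , pos , eq | i′ , pos′ , eq′ = trans eq (trans (cong 𝔄 (toℕ-injective same)) (sym eq′))
    where
    open ≡-Reasoning
    same : toℕ (ι i) ≡ toℕ i′
    same = begin
      toℕ (ι i)                       ≡⟨ ι-pos i ⟩
      o + toℕ i                       ≡⟨ cong (o +_) pos ⟩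
      o + (toℕ first + toℕ j)         ≡⟨ sym (+-assoc o (toℕ first) (toℕ j)) ⟩
      o + toℕ first + toℕ j           ≡⟨ cong₂ _+_ (sym (ι-pos first)) (sym (toℕ-cast e j)) ⟩
      toℕ (ι first) + toℕ (cast e j)  ≡⟨ sym pos′ ⟩
      toℕ i′                          ∎

block-left : ∀ {m k B} (𝔄 : Fin (m + k) → Tree) → Block (λ i → 𝔄 (i ↑ˡ k)) B → Block 𝔄 B
block-left {k = k} 𝔄 = block-embed 𝔄 (_↑ˡ k) 0 (λ i → toℕ-↑ˡ i k)

block-right : ∀ {m k B} (𝔄 : Fin (m + k) → Tree) → Block (λ i → 𝔄 (m ↑ʳ i)) B → Block 𝔄 B
block-right {m = m} 𝔄 = block-embed 𝔄 (m ↑ʳ_) m (toℕ-↑ʳ m)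

all-++ : ∀ {m k} {X : Set} (P : X → Set) (xs : Fin m → X) (ys : Fin k → X) →
         (∀ i → P (xs i)) → (∀ i → P (ys i)) → ∀ l → P ((xs ++ ys) l)
all-++ {m} P xs ys pxs pys l with Fin.splitAt m l
... | inj₁ i = pxs i
... | inj₂ i = pys i

record Decomposition (n : ℕ) (𝔄 : Fin n → Tree) (A : Ty) : Set where
  field
    size     : ℕ
    size≤n   : size ≤ n
    ctx      : Ctx size
    parts    : Fin size → Ty
    parts¬⊕  : ∀ l → ¬ RootedPlusTy (parts l)
    splits   : A ≡ plugTy ctx parts
    blocks   : ∀ l → Block 𝔄 (parts l)

decompose-atomic : ∀ {n A} (C : Ctx n) (𝔄 : Fin n → Tree) →
                   ¬ RootedPlusTy A → TEq A (plugT C 𝔄) → Decomposition n 𝔄 A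
decompose-atomic {A = A} C 𝔄 ¬⊕ q with ctx-nonempty C
... | _ , refl = record
  { size = 1 ; size≤n = s≤s z≤n ; ctx = hole ; parts = λ _ → A
  ; parts¬⊕ = λ _ → ¬⊕ ; splits = refl ; blocks = λ _ → block-whole C 𝔄 q }

decompose-⊕ : ∀ {m k B D} (𝔄 : Fin (m + k) → Tree) →
              Decomposition m (λ i → 𝔄 (i ↑ˡ k)) B →
              Decomposition k (λ i → 𝔄 (m ↑ʳ i)) D →
              Decomposition (m + k) 𝔄 (bin opPlus B D)
decompose-⊕ 𝔄 dB dD = record
  { size = size₁ + size₂
  ; size≤n = +-mono-≤ size≤n₁ size≤n₂
  ; ctx = ctx₁ ⊕ ctx₂
  ; parts = parts₁ ++ parts₂
  ; parts¬⊕ = all-++ (¬_ ∘ RootedPlusTy) parts₁ parts₂ parts¬⊕₁ parts¬⊕₂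
  ; splits = cong₂ (bin opPlus)
      (trans splits₁ (plugTy-cong ctx₁ (λ i → sym (lookup-++ˡ parts₁ parts₂ i))))
      (trans splits₂ (plugTy-cong ctx₂ (λ i → sym (lookup-++ʳ parts₁ parts₂ i))))
  ; blocks = all-++ (Block 𝔄) parts₁ parts₂
      (block-left 𝔄 ∘ blocks₁) (block-right 𝔄 ∘ blocks₂) }
  where
  open Decomposition dB renaming
    (size to size₁; size≤n to size≤n₁; ctx to ctx₁; parts to parts₁;
     parts¬⊕ to parts¬⊕₁; splits to splits₁; blocks to blocks₁)
  open Decomposition dD renaming
    (size to size₂; size≤n to size≤n₂; ctx to ctx₂; parts to parts₂;
     parts¬⊕ to parts¬⊕₂; splits to splits₂; blocks to blocks₂)

decompose : ∀ A {n} (C : Ctx n) (𝔄 : Fin n → Tree) → (∀ i → ¬ RootedPlusT (𝔄 i)) →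
            TEq A (plugT C 𝔄) → Decomposition n 𝔄 A
decompose (bin opPlus B D) hole 𝔄 ¬⊕ q = ⊥-elim (¬⊕ Fin.zero (proj₁ (q [] _) uroot))
decompose (bin opPlus B D) (_⊕_ {m} {k} C₁ C₂) 𝔄 ¬⊕ q =
  decompose-⊕ 𝔄 (decompose B C₁ _ (λ i → ¬⊕ (i ↑ˡ k)) (TEq-left q))
                (decompose D C₂ _ (λ i → ¬⊕ (m ↑ʳ i)) (TEq-right q))
decompose (var x)         C 𝔄 _ q = decompose-atomic C 𝔄 (λ { (_ , _ , ()) }) q
decompose (con x)         C 𝔄 _ q = decompose-atomic C 𝔄 (λ { (_ , _ , ()) }) q
decompose (bin opAt B D)  C 𝔄 _ q = decompose-atomic C 𝔄 (λ { (_ , _ , ()) }) q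
decompose (bin opArr B D) C 𝔄 _ q = decompose-atomic C 𝔄 (λ { (_ , _ , ()) }) q
decompose (μ B)           C 𝔄 _ q = decompose-atomic C 𝔄 (λ { (_ , _ , ()) }) q

-- The theorem: repackage the decomposition of A; each block context is
-- maximal because every filler of 𝔄 avoids a ⊕ root.
lemma3 : (Γ : List Kind) (A : Ty) → InT Γ A →
         (n : ℕ) (𝔄 : Fin n → Tree) →
         (∀ i → IsTree (𝔄 i)) → (∀ i → ¬ RootedPlusT (𝔄 i)) →
         IsMaxUnion A 𝔄 →
         Σ ℕ λ n′ → n′ ≤ n ×
         Σ (Ctx n′) λ C → Σ (Fin n′ → Ty) λ As →
         MaximalTy C As × (∀ l → ¬ RootedPlusTy (As l)) ×
         Σ (Fin n′ → Fin n) λ s → Σ (Fin n′ → Fin n) λ t →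
         Σ ((l : Fin n′) → s l Fin.≤ t l) λ st →
         A ≡ plugTy C As ×
         ((l : Fin n′) → Σ (Ctx (width (s l) (t l))) λ Cₗ →
            MaximalT Cₗ (slice 𝔄 (s l) (t l) (st l)) ×
            TEq (As l) (plugT Cₗ (slice 𝔄 (s l) (t l) (st l))))
lemma3 _ A _ n 𝔄 _ ¬⊕ (C , _ , q) =
  size , size≤n , ctx , parts , parts¬⊕ , parts¬⊕ ,
  Block.first ∘ blocks , Block.last ∘ blocks , Block.ordered ∘ blocks , splits ,
  λ l → Block.ctx (blocks l) , (λ j → ¬⊕ _) , Block.unfolds (blocks l)
  where open Decomposition (decompose A C 𝔄 ¬⊕ q)
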